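{- Let $O$ be a partial P-matroid USO on $\{0,1\}^n$. Then there exists a set $F$ of pairwise vertex-disjoint faces of the $n$-cube such that the set of unoriented half-edges of $O$ (pairs $(v,i)$ with $O(v)_i=0$) is exactly the union over $f\in F$ of the half-edges of $f$ (pairs $(v,i)$ with $v\in f$ and $i$ a dimension spanned by $f$). Furthermore, each $f\in F$ is a hypervertex of $O$.
   Context: Oriented matroids are given by their circuits (signed sets satisfying the standard circuit axioms). Let $E_{2n}=S\cup T$ with $S=\{s_1,\dots,s_n\}$, $T=\{t_1,\dots,t_n\}$; a set is complementary if it contains no pair $\{s_i,t_i\}$. An oriented matroid on $E_{2n}$ is a P-matroid if $S$ is a basis and no circuit $X$ satisfies $X_{s_i}=-X_{t_i}$ for every $i$ with $X_{s_i}\neq0\neq X_{t_i}$. An extension is an oriented matroid $\widehat{\mathcal M}$ on $E_{2n}\cup\{q\}$ whose circuits with $q$-entry $0$ are exactly the circuits of the original one; in an extension of a P-matroid every complementary $n$-subset of $S\cup T$ is a basis. For a basis $B$, $C(B,q)$ denotes the unique circuit $X$ with $X_q=+$ and support in $B\cup\{q\}$. For $v\in\{0,1\}^n$, $B(v)$ contains $s_i$ if $v_i=0$ and $t_i$ if $v_i=1$. The partial P-matroid USO of an extension $\widehat{\mathcal M}$ of a P-matroid is $O\colon\{0,1\}^n\to\{ -,0,+\}^n$ with, for $C=C(B(v),q)$: $O(v)_i=+$ if $C_{s_i}=-$ or $C_{t_i}=-$; $O(v)_i=-$ if $C_{s_i}=+$ or $C_{t_i}=+$; $O(v)_i=0$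 otherwise. A face of the cube is a set of vertices obtained by fixing some coordinates; its spanned dimensions are the free coordinates. A face $f$ is a hypervertex of $O$ if for every dimension $i$ not spanned by $f$ and all $v,w\in f$, $O(v)_i=O(w)_i$. -}

module Defs where

open import Data.Nat using (ℕ; suc; _+_)
open import Data.Fin using (Fin; zero; suc; _↑ˡ_; _↑ʳ_)
open import Data.Vec using (Vec; lookup; map; replicate; _∷_)
open import Data.Bool using (Bool; true; false)
open import Data.Maybe using (Maybe; just; nothing)
open import Data.Product using (Σ; ∃-syntax; _×_; _,_)
open import Data.Sum using (_⊎_)
open import Data.Unit using (⊤)
open import Data.List using (List)
open import Data.List.Membership.Propositional using (_∈_)
open import Relation.Binary.PropositionalEquality using (_≡_; _≢_)
open import Relation.Nullary using (¬_)

data Sign : Set where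
  ⊖ ⊙ ⊕ : Sign

-ˢ_ : Sign → Sign
-ˢ ⊖ = ⊕
-ˢ ⊙ = ⊙
-ˢ ⊕ = ⊖

opp : ∀ {m} → Vec Sign m → Vec Sign m
opp X = map -ˢ_ X

GSet : ℕ → Set₁
GSet m = Fin m → Set

supp⊆ : ∀ {m} → Vec Sign m → GSet m → Set
supp⊆ X A = ∀ e → lookup X e ≢ ⊙ → A e

record IsOM {m : ℕ} (C : Vec Sign m → Set) : Set where
  field
    C0 : ¬ C (replicate m ⊙)
    C1 : ∀ X → C X → C (opp X)
    C2 : ∀ X Y → C X → C Y → (∀ e → lookup X e ≢ ⊙ → lookup Y e ≢ ⊙) →
         (X ≡ Y) ⊎ (X ≡ opp Y)
    C3 : ∀ X Y e → C X → C Y → X ≢ opp Y → lookup X e ≡ ⊕ → lookup Y e ≡ ⊖ →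
         ∃[ Z ] (C Z
           × (∀ f → lookup Z f ≡ ⊕ → (f ≢ e) × ((lookup X f ≡ ⊕) ⊎ (lookup Y f ≡ ⊕)))
           × (∀ f → lookup Z f ≡ ⊖ → (f ≢ e) × ((lookup X f ≡ ⊖) ⊎ (lookup Y f ≡ ⊖))))

Dependent : ∀ {m} → (Vec Sign m → Set) → GSet m → Set
Dependent C A = ∃[ X ] (C X × supp⊆ X A)

Independent : ∀ {m} → (Vec Sign m → Set) → GSet m → Set
Independent C A = ¬ Dependent C A

IsBasis : ∀ {m} → (Vec Sign m → Set) → GSet m → Set
IsBasis C B = Independent C B × (∀ e → ¬ B e → Dependent C (λ x → B x ⊎ x ≡ e))

-- The ground set E_{2n} = S ∪ T is Fin (n + n) with s_i = i ↑ˡ n, t_i = n ↑ʳ i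

s : ∀ {n} → Fin n → Fin (n + n)
s {n} i = i ↑ˡ n

t : ∀ {n} → Fin n → Fin (n + n)
t {n} i = n ↑ʳ i

Sset : ∀ {n} → GSet (n + n)
Sset {n} e = ∃[ i ] (e ≡ s {n} i)

IsPMatroid : ∀ n → (Vec Sign (n + n) → Set) → Set
IsPMatroid n C =
  IsOM C × IsBasis C (Sset {n}) ×
  ¬ (∃[ X ] (C X × (∀ (i : Fin n) → lookup X (s i) ≢ ⊙ → lookup X (t i) ≢ ⊙ →
                          lookup X (s i) ≡ -ˢ (lookup X (t i)))))

-- Extended ground set E_{2n} ∪ {q} = Fin (suc (n + n)) with q = zero,
-- and e ∈ E_{2n} embedded as suc e.
IsExtension : ∀ {m} → (Vec Sign m → Set) → (Vec Sign (suc m) → Set) → Set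
IsExtension C Ĉ = IsOM Ĉ × (∀ X → (C X → Ĉ (⊙ ∷ X)) × (Ĉ (⊙ ∷ X) → C X))

Bv : ∀ {n} → Vec Bool n → GSet (n + n)
Bv {n} v e = ∃[ i ] (((lookup v i ≡ false) × (e ≡ s i)) ⊎ ((lookup v i ≡ true) × (e ≡ t i)))

Bvq : ∀ {n} → Vec Bool n → GSet (suc (n + n))
Bvq v zero = ⊤
Bvq v (suc e) = Bv v e

IsFundCircuit : ∀ {n} → (Vec Sign (suc (n + n)) → Set) → Vec Bool n → Vec Sign (suc (n + n)) → Set
IsFundCircuit Ĉ v X = Ĉ X × (lookup X zero ≡ ⊕) × supp⊆ X (Bvq v)

-- O(v)_i from (C_{s_i}, C_{t_i}): + if one is -, - if one is +, 0 otherwise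
-- (at most one of them is nonzero since supp C ⊆ B(v) ∪ {q})
usoEntry : Sign → Sign → Sign
usoEntry ⊖ _ = ⊕
usoEntry _ ⊖ = ⊕
usoEntry ⊕ _ = ⊖
usoEntry _ ⊕ = ⊖
usoEntry ⊙ ⊙ = ⊙

IsPartialPUSO : ∀ n → (Vec Sign (suc (n + n)) → Set) → (Vec Bool n → Vec Sign n) → Set
IsPartialPUSO n Ĉ O =
  ∀ v → ∃[ X ] (IsFundCircuit Ĉ v X ×
                (∀ i → lookup (O v) i ≡ usoEntry (lookup X (suc (s i))) (lookup X (suc (t i)))))

-- Faces of the cube: nothing = free (spanned) coordinate, just b = fixed to b

Face : ℕ → Set
Face n = Vec (Maybe Bool) n

_∈ᶠ_ : ∀ {n} → Vec Bool n → Face n → Set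
v ∈ᶠ f = ∀ i b → lookup f i ≡ just b → lookup v i ≡ b

Spans : ∀ {n} → Face n → Fin n → Set
Spans f i = lookup f i ≡ nothing

VertexDisjoint : ∀ {n} → Face n → Face n → Set
VertexDisjoint f g = ¬ (∃[ v ] ((v ∈ᶠ f) × (v ∈ᶠ g)))

IsHypervertex : ∀ {n} → (Vec Bool n → Vec Sign n) → Face n → Set
IsHypervertex O f = ∀ i → ¬ Spans f i → ∀ v w → v ∈ᶠ f → w ∈ᶠ f → lookup (O v) i ≡ lookup (O w) i

-- The fundamental circuit C(B(v), q) is unique: two distinct ones could be
-- eliminated at q, leaving a circuit of the P-matroid supported on the
-- complementary set B(v), and such a circuit satisfies the forbidden sign
-- pattern vacuously. Let f(v) be the face through v spanned by the
-- dimensions i with O(v)_i = 0. For w in f(v) the circuit C(B(v), q) is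
-- still supported in B(w) ∪ {q}, because B(v) and B(w) differ only in
-- coordinates where C(B(v), q) vanishes; hence it is C(B(w), q), so O is
-- constant on f(v) and f(w) = f(v). The faces f(v) thus partition the cube
-- into hypervertices whose spanned dimensions are exactly the unoriented ones.
module Submission where

open import Defs
open import Data.Nat using (ℕ; suc; _+_)
open import Data.Fin using (Fin; zero; suc; splitAt)
open import Data.Fin.Properties using (↑ˡ-injective; ↑ʳ-injective; splitAt-↑ˡ; splitAt-↑ʳ)
open import Data.Vec using (Vec; lookup; map; tabulate; []; _∷_)
open import Data.Vec.Properties using (lookup-map; lookup∘tabulate; map-∘; map-cong; map-id)
import Data.Vec.Properties as Vec
open import Data.Vec.Relation.Binary.Pointwise.Extensional using (ext; Pointwise-≡⇒≡)
open import Data.Bool using (Bool; true; false)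
import Data.Bool.Properties as Bool
open import Data.Maybe using (Maybe; just; nothing)
import Data.Maybe.Properties as Maybe
open import Data.Product using (∃-syntax; _×_; _,_; proj₁; proj₂)
open import Data.Sum using (inj₁; inj₂)
open import Data.Unit using (tt)
open import Function using (_∘_)
open import Data.List using (List; cartesianProductWith; deduplicate)
import Data.List as List
open import Data.List.Membership.Propositional using (_∈_)
open import Data.List.Membership.Propositional.Properties
  using (∈-cartesianProductWith⁺; ∈-map⁺; ∈-map⁻; ∈-deduplicate⁺; ∈-deduplicate⁻)
open import Data.List.Relation.Unary.Any using (here; there)
open import Data.List.Relation.Unary.All using (All) renaming ([] to []ᴬ; _∷_ to _∷ᴬ_)
import Data.List.Relation.Unary.All as All
open import Data.List.Relation.Unary.Unique.DecPropositional.Properties using (deduplicate-!)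
open import Data.List.Relation.Unary.AllPairs using (AllPairs)
  renaming ([] to []ᴾ; _∷_ to _∷ᴾ_)
open import Relation.Binary.PropositionalEquality
  using (_≡_; _≢_; refl; sym; trans; cong; subst; module ≡-Reasoning)
open import Relation.Binary.Core using (Rel)
open import Relation.Binary.Definitions using (DecidableEquality)
open import Relation.Unary using (Pred)
open import Relation.Nullary using (¬_; yes; no; contradiction)

_≟ˢ_ : DecidableEquality Sign
⊖ ≟ˢ ⊖ = yes refl
⊖ ≟ˢ ⊙ = no λ ()
⊖ ≟ˢ ⊕ = no λ ()
⊙ ≟ˢ ⊖ = no λ ()
⊙ ≟ˢ ⊙ = yes refl
⊙ ≟ˢ ⊕ = no λ ()
⊕ ≟ˢ ⊖ = no λ ()
⊕ ≟ˢ ⊙ = no λ ()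
⊕ ≟ˢ ⊕ = yes refl

-ˢ-involutive : ∀ a → -ˢ (-ˢ a) ≡ a
-ˢ-involutive ⊖ = refl
-ˢ-involutive ⊙ = refl
-ˢ-involutive ⊕ = refl

opp-involutive : ∀ {m} (X : Vec Sign m) → opp (opp X) ≡ X
opp-involutive X = begin
  map -ˢ_ (map -ˢ_ X)  ≡⟨ map-∘ -ˢ_ -ˢ_ X ⟨
  map (-ˢ_ ∘ -ˢ_) X    ≡⟨ map-cong -ˢ-involutive X ⟩
  map (λ a → a) X      ≡⟨ map-id X ⟩
  X                    ∎
  where open ≡-Reasoning

≡⊕⇒≢⊙ : ∀ {a} → a ≡ ⊕ → a ≢ ⊙
≡⊕⇒≢⊙ refl ()

≡⊖⇒≢⊙ : ∀ {a} → a ≡ ⊖ → a ≢ ⊙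
≡⊖⇒≢⊙ refl ()

-ˢ-≢⊙ : ∀ a → -ˢ a ≢ ⊙ → a ≢ ⊙
-ˢ-≢⊙ ⊖ _ ()
-ˢ-≢⊙ ⊙ nz = λ _ → nz refl
-ˢ-≢⊙ ⊕ _ ()

supp⊆-outside : ∀ {m} {Z : Vec Sign m} {A : GSet m} {e} → supp⊆ Z A → ¬ A e → lookup Z e ≡ ⊙
supp⊆-outside {Z = Z} {e = e} Z⊆A e∉A with lookup Z e ≟ˢ ⊙
... | yes Ze≡⊙ = Ze≡⊙
... | no  Ze≢⊙ with () ← e∉A (Z⊆A e Ze≢⊙)

supp⊆-opp : ∀ {m} (Y : Vec Sign m) {A : GSet m} → supp⊆ Y A → supp⊆ (opp Y) A
supp⊆-opp Y Y⊆A e nz = Y⊆A e (-ˢ-≢⊙ (lookup Y e) (subst (_≢ ⊙) (lookup-map e -ˢ_ Y) nz))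

usoEntry≡⊙ : ∀ a b → usoEntry a b ≡ ⊙ → (a ≡ ⊙) × (b ≡ ⊙)
usoEntry≡⊙ ⊙ ⊙ _ = refl , refl
usoEntry≡⊙ ⊖ _ ()
usoEntry≡⊙ ⊙ ⊖ ()
usoEntry≡⊙ ⊙ ⊕ ()
usoEntry≡⊙ ⊕ ⊖ ()
usoEntry≡⊙ ⊕ ⊙ ()
usoEntry≡⊙ ⊕ ⊕ ()

module _ {m} {C : Vec Sign m → Set} (om : IsOM C) where
  open IsOM om

  circuit-elimination : ∀ {X Y : Vec Sign m} {A : GSet m} e → C X → C Y → X ≢ Y →
    lookup X e ≡ ⊕ → lookup Y e ≡ ⊕ → supp⊆ X A → supp⊆ Y A →
    ∃[ Z ] (C Z × supp⊆ Z (λ f → f ≢ e × A f))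
  circuit-elimination {X} {Y} {A} e cX cY X≢Y Xe Ye X⊆A Y⊆A
    with C3 X (opp Y) e cX (C1 Y cY) (λ X≡Y⁻⁻ → X≢Y (trans X≡Y⁻⁻ (opp-involutive Y)))
            Xe (trans (lookup-map e -ˢ_ Y) (cong -ˢ_ Ye))
  ... | Z , cZ , Z⁺ , Z⁻ = Z , cZ , Z⊆
    where
    Y⁻⊆A : supp⊆ (opp Y) A
    Y⁻⊆A = supp⊆-opp Y Y⊆A

    Z⊆ : supp⊆ Z (λ f → f ≢ e × A f)
    Z⊆ f nz with lookup Z f in Zf
    ... | ⊙ with () ← nz refl
    ... | ⊕ with Z⁺ f Zf
    ...   | f≢e , inj₁ Xf = f≢e , X⊆A f (≡⊕⇒≢⊙ Xf)
    ...   | f≢e , inj₂ Yf = f≢e , Y⁻⊆A f (≡⊕⇒≢⊙ Yf)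
    Z⊆ f nz | ⊖ with Z⁻ f Zf
    ...   | f≢e , inj₁ Xf = f≢e , X⊆A f (≡⊖⇒≢⊙ Xf)
    ...   | f≢e , inj₂ Yf = f≢e , Y⁻⊆A f (≡⊖⇒≢⊙ Yf)

circuit-through-q-unique : ∀ {m} {C : Vec Sign m → Set} {Ĉ : Vec Sign (suc m) → Set}
  {A : GSet (suc m)} {X Y : Vec Sign (suc m)} →
  IsExtension C Ĉ → Independent C (λ e → A (suc e)) →
  Ĉ X → Ĉ Y → lookup X zero ≡ ⊕ → lookup Y zero ≡ ⊕ → supp⊆ X A → supp⊆ Y A → X ≡ Y
circuit-through-q-unique {X = X} {Y} (om , circuits) indep cX cY Xq Yq X⊆A Y⊆A
  with Vec.≡-dec _≟ˢ_ X Y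
... | yes X≡Y = X≡Y
... | no  X≢Y with circuit-elimination om zero cX cY X≢Y Xq Yq X⊆A Y⊆A
...   | z ∷ Z , cZ , Z⊆ with supp⊆-outside {Z = z ∷ Z} Z⊆ (λ (q≢q , _) → q≢q refl)
...     | refl with () ← indep (Z , proj₂ (circuits Z) cZ , λ e nz → proj₂ (Z⊆ (suc e) nz))

module _ {n : ℕ} where

  s≢t : ∀ (i j : Fin n) → s i ≢ t j
  s≢t i j sᵢ≡tⱼ with () ← trans (sym (splitAt-↑ˡ n i n))
                             (trans (cong (splitAt n) sᵢ≡tⱼ) (splitAt-↑ʳ n n j))

  Bv-s : ∀ (w : Vec Bool n) i → Bv w (s i) → lookup w i ≡ false
  Bv-s w i (j , inj₁ (wj , sᵢ≡sⱼ)) with refl ← ↑ˡ-injective n i j sᵢ≡sⱼ = wj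
  Bv-s w i (j , inj₂ (_ , sᵢ≡tⱼ)) with () ← s≢t i j sᵢ≡tⱼ

  Bv-t : ∀ (w : Vec Bool n) i → Bv w (t i) → lookup w i ≡ true
  Bv-t w i (j , inj₂ (wj , tᵢ≡tⱼ)) with refl ← ↑ʳ-injective n i j tᵢ≡tⱼ = wj
  Bv-t w i (j , inj₁ (_ , tᵢ≡sⱼ)) with () ← s≢t j i (sym tᵢ≡sⱼ)

  Bv-independent : ∀ {C} → IsPMatroid n C → ∀ w → Independent C (Bv w)
  Bv-independent (_ , _ , no-sign-reversal) w (X , cX , X⊆Bw) =
    no-sign-reversal (X , cX , λ i sᵢ tᵢ →
      contradiction (trans (sym (Bv-s w i (X⊆Bw (s i) sᵢ))) (Bv-t w i (X⊆Bw (t i) tᵢ))) λ ())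

  fundCircuit-unique : ∀ {C Ĉ} {w : Vec Bool n} {X Y} → IsPMatroid n C → IsExtension C Ĉ →
    IsFundCircuit Ĉ w X → IsFundCircuit Ĉ w Y → X ≡ Y
  fundCircuit-unique {w = w} P E (cX , Xq , X⊆) (cY , Yq , Y⊆) =
    circuit-through-q-unique {A = Bvq w} E (Bv-independent P w) cX cY Xq Yq X⊆ Y⊆

  supp⊆-Bvq-transfer : ∀ (X : Vec Sign (suc (n + n))) (v w : Vec Bool n) →
    (∀ i → ¬ (lookup X (suc (s i)) ≡ ⊙ × lookup X (suc (t i)) ≡ ⊙) → lookup w i ≡ lookup v i) →
    supp⊆ X (Bvq v) → supp⊆ X (Bvq w)
  supp⊆-Bvq-transfer X v w agree X⊆ zero    _  = tt
  supp⊆-Bvq-transfer X v w agree X⊆ (suc e) nz with X⊆ (suc e) nz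
  ... | i , inj₁ (vᵢ , refl) = i , inj₁ (trans (agree i λ (sᵢ≡⊙ , _) → nz sᵢ≡⊙) vᵢ , refl)
  ... | i , inj₂ (vᵢ , refl) = i , inj₂ (trans (agree i λ (_ , tᵢ≡⊙) → nz tᵢ≡⊙) vᵢ , refl)

fixUnlessZero : Sign → Bool → Maybe Bool
fixUnlessZero ⊙ _ = nothing
fixUnlessZero ⊕ b = just b
fixUnlessZero ⊖ b = just b

fixUnlessZero-≢⊙ : ∀ {a} b → a ≢ ⊙ → fixUnlessZero a b ≡ just b
fixUnlessZero-≢⊙ {⊙} _ nz with () ← nz refl
fixUnlessZero-≢⊙ {⊕} _ _ = refl
fixUnlessZero-≢⊙ {⊖} _ _ = refl

fixUnlessZero-just : ∀ a {b c} → fixUnlessZero a b ≡ just c → b ≡ c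
fixUnlessZero-just ⊕ refl = refl
fixUnlessZero-just ⊖ refl = refl

fixUnlessZero-nothing : ∀ a {b} → fixUnlessZero a b ≡ nothing → a ≡ ⊙
fixUnlessZero-nothing ⊙ _ = refl

fixUnlessZero-cong : ∀ a {b c} → (a ≢ ⊙ → b ≡ c) → fixUnlessZero a b ≡ fixUnlessZero a c
fixUnlessZero-cong ⊙ _   = refl
fixUnlessZero-cong ⊕ b≡c = cong just (b≡c λ ())
fixUnlessZero-cong ⊖ b≡c = cong just (b≡c λ ())

module _ {n : ℕ} (O : Vec Bool n → Vec Sign n) where

  vertexFace : Vec Bool n → Face n
  vertexFace v = tabulate λ i → fixUnlessZero (lookup (O v) i) (lookup v i)

  private
    lookup-vertexFace : ∀ v i → lookup (vertexFace v) i ≡ fixUnlessZero (lookup (O v) i) (lookup v i)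
    lookup-vertexFace v i = lookup∘tabulate _ i

  ∈-vertexFace : ∀ v → v ∈ᶠ vertexFace v
  ∈-vertexFace v i b fᵢ≡b =
    fixUnlessZero-just (lookup (O v) i) (trans (sym (lookup-vertexFace v i)) fᵢ≡b)

  vertexFace-fixes : ∀ v w i → w ∈ᶠ vertexFace v → lookup (O v) i ≢ ⊙ → lookup w i ≡ lookup v i
  vertexFace-fixes v w i w∈f nz =
    w∈f i (lookup v i) (trans (lookup-vertexFace v i) (fixUnlessZero-≢⊙ (lookup v i) nz))

  spans-vertexFace⁺ : ∀ v i → lookup (O v) i ≡ ⊙ → Spans (vertexFace v) i
  spans-vertexFace⁺ v i Oᵢ≡⊙ =
    trans (lookup-vertexFace v i) (cong (λ a → fixUnlessZero a (lookup v i)) Oᵢ≡⊙)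

  spans-vertexFace⁻ : ∀ v i → Spans (vertexFace v) i → lookup (O v) i ≡ ⊙
  spans-vertexFace⁻ v i sp =
    fixUnlessZero-nothing (lookup (O v) i) (trans (sym (lookup-vertexFace v i)) sp)

  vertexFace-stable : ∀ v w → O w ≡ O v → w ∈ᶠ vertexFace v → vertexFace w ≡ vertexFace v
  vertexFace-stable v w Ow≡Ov w∈f = Pointwise-≡⇒≡ (ext λ i → begin
    lookup (vertexFace w) i                      ≡⟨ lookup-vertexFace w i ⟩
    fixUnlessZero (lookup (O w) i) (lookup w i)  ≡⟨ cong (λ o → fixUnlessZero (lookup o i) (lookup w i)) Ow≡Ov ⟩
    fixUnlessZero (lookup (O v) i) (lookup w i)  ≡⟨ fixUnlessZero-cong (lookup (O v) i) (vertexFace-fixes v w i w∈f) ⟩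
    fixUnlessZero (lookup (O v) i) (lookup v i)  ≡⟨ lookup-vertexFace v i ⟨
    lookup (vertexFace v) i                      ∎)
    where open ≡-Reasoning

AllPairs-restrict : ∀ {a ℓ₁ ℓ₂ ℓ₃} {A : Set a} {P : Pred A ℓ₁} {R : Rel A ℓ₂} {S : Rel A ℓ₃} →
  (∀ {x y} → P x → P y → R x y → S x y) → ∀ {xs} → All P xs → AllPairs R xs → AllPairs S xs
AllPairs-restrict R⇒S []ᴬ         []ᴾ         = []ᴾ
AllPairs-restrict R⇒S (px ∷ᴬ pxs) (rx ∷ᴾ rxs) =
  All.zipWith (λ (py , r) → R⇒S px py r) (pxs , rx) ∷ᴾ AllPairs-restrict R⇒S pxs rxs

vertices : ∀ n → List (Vec Bool n)
vertices 0       = List.[ [] ]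
vertices (suc n) = cartesianProductWith _∷_ (true List.∷ List.[ false ]) (vertices n)

∈-vertices : ∀ {n} (v : Vec Bool n) → v ∈ vertices n
∈-vertices []      = here refl
∈-vertices (b ∷ v) = ∈-cartesianProductWith⁺ _∷_ (∈-bools b) (∈-vertices v)
  where
  ∈-bools : ∀ b → b ∈ true List.∷ List.[ false ]
  ∈-bools true  = here refl
  ∈-bools false = there (here refl)

_≟ᶠ_ : ∀ {n} → DecidableEquality (Face n)
_≟ᶠ_ = Vec.≡-dec (Maybe.≡-dec Bool._≟_)

module FaceClasses {n : ℕ} (c : Vec Bool n → Face n)
                   (c-stable : ∀ v w → w ∈ᶠ c v → c w ≡ c v) where

  classes : List (Face n)
  classes = deduplicate _≟ᶠ_ (List.map c (vertices n))

  ∈-classes⁺ : ∀ v → c v ∈ classes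
  ∈-classes⁺ v = ∈-deduplicate⁺ _≟ᶠ_ (∈-map⁺ c (∈-vertices v))

  ∈-classes⁻ : ∀ {f} → f ∈ classes → ∃[ u ] (f ≡ c u)
  ∈-classes⁻ f∈ with u , _ , f≡cu ← ∈-map⁻ c (∈-deduplicate⁻ _≟ᶠ_ _ f∈) = u , f≡cu

  classes-disjoint : AllPairs VertexDisjoint classes
  classes-disjoint =
    AllPairs-restrict distinct-disjoint (All.tabulate ∈-classes⁻) (deduplicate-! _≟ᶠ_ _)
    where
    distinct-disjoint : ∀ {f g} → ∃[ u ] (f ≡ c u) → ∃[ u ] (g ≡ c u) → f ≢ g → VertexDisjoint f g
    distinct-disjoint (u , refl) (u′ , refl) cu≢cu′ (w , w∈cu , w∈cu′) =
      cu≢cu′ (trans (sym (c-stable u w w∈cu)) (c-stable u′ w w∈cu′))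

module PartialPUSO {n : ℕ} {C : Vec Sign (n + n) → Set} {Ĉ : Vec Sign (suc (n + n)) → Set}
                  {O : Vec Bool n → Vec Sign n}
                  (P : IsPMatroid n C) (E : IsExtension C Ĉ) (U : IsPartialPUSO n Ĉ O) where

  circuit : Vec Bool n → Vec Sign (suc (n + n))
  circuit v = proj₁ (U v)

  circuit-fund : ∀ v → IsFundCircuit Ĉ v (circuit v)
  circuit-fund v = proj₁ (proj₂ (U v))

  usoEntryOf : Vec Sign (suc (n + n)) → Fin n → Sign
  usoEntryOf X i = usoEntry (lookup X (suc (s i))) (lookup X (suc (t i)))

  O-from-circuit : ∀ v i → lookup (O v) i ≡ usoEntryOf (circuit v) i
  O-from-circuit v = proj₂ (proj₂ (U v))

  circuit-on-vertexFace : ∀ v w → w ∈ᶠ vertexFace O v → IsFundCircuit Ĉ w (circuit v)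
  circuit-on-vertexFace v w w∈f with cX , Xq , X⊆ ← circuit-fund v =
    cX , Xq , supp⊆-Bvq-transfer (circuit v) v w agree X⊆
    where
    agree : ∀ i → ¬ (lookup (circuit v) (suc (s i)) ≡ ⊙ × lookup (circuit v) (suc (t i)) ≡ ⊙) →
            lookup w i ≡ lookup v i
    agree i not-both = vertexFace-fixes O v w i w∈f λ Oᵢ≡⊙ →
      not-both (usoEntry≡⊙ _ _ (trans (sym (O-from-circuit v i)) Oᵢ≡⊙))

  O-constant-on-vertexFace : ∀ v w → w ∈ᶠ vertexFace O v → O w ≡ O v
  O-constant-on-vertexFace v w w∈f = Pointwise-≡⇒≡ (ext λ i → begin
    lookup (O w) i                ≡⟨ O-from-circuit w i ⟩
    usoEntryOf (circuit w) i      ≡⟨ cong (λ X → usoEntryOf X i) same-circuit ⟩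
    usoEntryOf (circuit v) i      ≡⟨ O-from-circuit v i ⟨
    lookup (O v) i                ∎)
    where
    open ≡-Reasoning
    same-circuit : circuit w ≡ circuit v
    same-circuit = fundCircuit-unique {C = C} {Ĉ} {w} {circuit w} {circuit v}
                     P E (circuit-fund w) (circuit-on-vertexFace v w w∈f)

  vertexFace-on-vertexFace : ∀ v w → w ∈ᶠ vertexFace O v → vertexFace O w ≡ vertexFace O v
  vertexFace-on-vertexFace v w w∈f = vertexFace-stable O v w (O-constant-on-vertexFace v w w∈f) w∈f

  vertexFace-unoriented : ∀ u v i → v ∈ᶠ vertexFace O u → Spans (vertexFace O u) i → lookup (O v) i ≡ ⊙
  vertexFace-unoriented u v i v∈f sp =
    trans (cong (λ o → lookup o i) (O-constant-on-vertexFace u v v∈f)) (spans-vertexFace⁻ O u i sp)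

  vertexFace-hypervertex : ∀ u → IsHypervertex O (vertexFace O u)
  vertexFace-hypervertex u i _ v w v∈f w∈f = cong (λ o → lookup o i)
    (trans (O-constant-on-vertexFace u v v∈f) (sym (O-constant-on-vertexFace u w w∈f)))

lemma3p5 : (n : ℕ) (C : Vec Sign (n + n) → Set) (Ĉ : Vec Sign (suc (n + n)) → Set)
    (O : Vec Bool n → Vec Sign n) →
    IsPMatroid n C → IsExtension C Ĉ → IsPartialPUSO n Ĉ O →
    ∃[ F ] (AllPairs VertexDisjoint F
      × (∀ v i → (lookup (O v) i ≡ ⊙ → ∃[ f ] ((f ∈ F) × (v ∈ᶠ f) × Spans f i))
               × (∃[ f ] ((f ∈ F) × (v ∈ᶠ f) × Spans f i) → lookup (O v) i ≡ ⊙))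
      × (∀ f → f ∈ F → IsHypervertex O f))
lemma3p5 n C Ĉ O P E U =
  classes , classes-disjoint , (λ v i → unoriented⇒covered v i , covered⇒unoriented) , hypervertex
  where
  open PartialPUSO {O = O} P E U
  open FaceClasses (vertexFace O) vertexFace-on-vertexFace

  unoriented⇒covered : ∀ v i → lookup (O v) i ≡ ⊙ → ∃[ f ] ((f ∈ classes) × (v ∈ᶠ f) × Spans f i)
  unoriented⇒covered v i Oᵢ≡⊙ =
    vertexFace O v , ∈-classes⁺ v , ∈-vertexFace O v , spans-vertexFace⁺ O v i Oᵢ≡⊙

  covered⇒unoriented : ∀ {v i} → ∃[ f ] ((f ∈ classes) × (v ∈ᶠ f) × Spans f i) → lookup (O v) i ≡ ⊙
  covered⇒unoriented {v} {i} (f , f∈ , v∈f , sp) with u , refl ← ∈-classes⁻ f∈ =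
    vertexFace-unoriented u v i v∈f sp

  hypervertex : ∀ f → f ∈ classes → IsHypervertex O f
  hypervertex f f∈ with u , refl ← ∈-classes⁻ f∈ = vertexFace-hypervertex u
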